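{- For every $n\geq1$ and every $e\in\mathbf{I}_n(100,210,201)$, we have $\mathrm{Fix}(e)\cup\mathrm{Tr}(e)\cup\mathrm{Tl}(e)=[n]$.
   Context: An inversion sequence of length $n$ is a word $e=e_1\cdots e_n$ with $0\leq e_i\leq i-1$; $\mathbf{I}_n$ is the set of them. A word avoids a pattern $p$ of length 3 if no subsequence $e_ie_je_k$ ($i<j<k$) is order isomorphic to $p$; $\mathbf{I}_n(100,210,201)$ is the set of $e\in\mathbf{I}_n$ avoiding $100$, $210$ and $201$. Set the convention $e_0=e_{n+1}=+\infty$. Define $\mathrm{Pk}(e)=\{i\in[n]:e_{i-1}<e_i\geq e_{i+1}\}$, $\mathrm{Va}(e)=\{i\in[n]:e_{i-1}\geq e_i<e_{i+1}\}$, $\mathrm{Sf}(e)=\{i\in[n], i\geq 3: e_{i-1}<e_{i-2}=e_i\neq e_{i+1}\}$, $\mathrm{Su}(e)=\{i\in[n], i\geq3: e_{i-1}<e_{i-2}=e_i=e_{i+1}\}$, $\mathrm{Fix}(e)=(\mathrm{Pk}(e)\setminus\mathrm{Su}(e))\cup\mathrm{Va}(e)\cup\mathrm{Sf}(e)$, $\mathrm{Tr}(e)=\{i\in[n]\setminus\mathrm{Fix}(e): e_{i-1}=e_i\}\cup\{1: e_1=e_2=0\}\cup\mathrm{Su}(e)$, and $\mathrm{Tl}(e)=\{i\in[n]\setminus\mathrm{Fix}(e):e_{i-1}<e_i\}$. -}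

module Defs where

open import Data.Nat using (ℕ; zero; suc; _<_; _≤_; _<?_)
open import Data.Fin using (Fin; toℕ; fromℕ<)
open import Data.Maybe using (Maybe; just; nothing)
open import Data.Product using (_×_; Σ)
open import Data.Sum using (_⊎_)
open import Data.Empty using (⊥)
open import Relation.Nullary using (¬_; yes; no)
open import Relation.Binary.PropositionalEquality using (_≡_)
open import Function.Bundles using (_⇔_)

-- An inversion sequence of length n, stored 0-indexed: e (j) is e_{j+1},
-- with the condition e_{j+1} ≤ j.
IsInversionSeq : (n : ℕ) → (Fin n → ℕ) → Set
IsInversionSeq n e = ∀ (j : Fin n) → e j ≤ toℕ j

SameOrder : ℕ → ℕ → ℕ → ℕ → Set
SameOrder a b x y = ((a < b) ⇔ (x < y)) × ((a ≡ b) ⇔ (x ≡ y))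

OrderIso3 : ℕ → ℕ → ℕ → ℕ → ℕ → ℕ → Set
OrderIso3 a b c x y z = SameOrder a b x y × SameOrder a c x z × SameOrder b c y z

Avoids : {n : ℕ} → (Fin n → ℕ) → ℕ → ℕ → ℕ → Set
Avoids {n} e p₁ p₂ p₃ =
  ∀ (i j k : Fin n) → toℕ i < toℕ j → toℕ j < toℕ k →
  ¬ OrderIso3 (e i) (e j) (e k) p₁ p₂ p₃

InI-100-210-201 : (n : ℕ) → (Fin n → ℕ) → Set
InI-100-210-201 n e =
  IsInversionSeq n e × Avoids e 1 0 0 × Avoids e 2 1 0 × Avoids e 2 0 1

-- Extended values: nothing = +∞.
ℕ∞ : Set
ℕ∞ = Maybe ℕ

data _<∞_ : ℕ∞ → ℕ∞ → Set where
  fin<fin : ∀ {a b} → a < b → just a <∞ just b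
  fin<∞   : ∀ {a} → just a <∞ nothing

_≥∞_ : ℕ∞ → ℕ∞ → Set
a ≥∞ b = ¬ (a <∞ b)

-- 1-indexed access with the convention e_0 = e_{n+1} = +∞
-- (positions > n + 1 are also +∞; they are never used for i ∈ [n]).
at : {n : ℕ} → (Fin n → ℕ) → ℕ → ℕ∞
at e zero = nothing
at {n} e (suc k) with k <? n
... | yes k<n = just (e (fromℕ< k<n))
... | no _ = nothing

In[_] : ℕ → ℕ → Set
In[ n ] i = (1 ≤ i) × (i ≤ n)

module _ {n : ℕ} (e : Fin n → ℕ) where

  Pk : ℕ → Set
  Pk zero = ⊥
  Pk (suc k) = In[ n ] (suc k) × (at e k <∞ at e (suc k)) × (at e (suc k) ≥∞ at e (suc (suc k)))

  Va : ℕ → Set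
  Va zero = ⊥
  Va (suc k) = In[ n ] (suc k) × (at e k ≥∞ at e (suc k)) × (at e (suc k) <∞ at e (suc (suc k)))

  Sf : ℕ → Set
  Sf zero = ⊥
  Sf (suc zero) = ⊥
  Sf (suc (suc zero)) = ⊥
  Sf (suc (suc (suc k))) =
    In[ n ] (3 Data.Nat.+ k) ×
    (at e (2 Data.Nat.+ k) <∞ at e (1 Data.Nat.+ k)) ×
    (at e (1 Data.Nat.+ k) ≡ at e (3 Data.Nat.+ k)) ×
    ¬ (at e (3 Data.Nat.+ k) ≡ at e (4 Data.Nat.+ k))

  Su : ℕ → Set
  Su zero = ⊥
  Su (suc zero) = ⊥
  Su (suc (suc zero)) = ⊥
  Su (suc (suc (suc k))) =
    In[ n ] (3 Data.Nat.+ k) ×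
    (at e (2 Data.Nat.+ k) <∞ at e (1 Data.Nat.+ k)) ×
    (at e (1 Data.Nat.+ k) ≡ at e (3 Data.Nat.+ k)) ×
    (at e (3 Data.Nat.+ k) ≡ at e (4 Data.Nat.+ k))

  Fix : ℕ → Set
  Fix i = (Pk i × ¬ Su i) ⊎ Va i ⊎ Sf i

  Tr : ℕ → Set
  Tr zero = ⊥
  Tr (suc k) =
    (In[ n ] (suc k) × ¬ Fix (suc k) × (at e k ≡ at e (suc k)))
    ⊎ ((suc k ≡ 1) × (at e 1 ≡ just 0) × (at e 2 ≡ just 0))
    ⊎ Su (suc k)

  Tl : ℕ → Set
  Tl zero = ⊥
  Tl (suc k) = In[ n ] (suc k) × ¬ Fix (suc k) × (at e k <∞ at e (suc k))

-- A position i ∉ Fix(e) lies in Tl(e) if e_{i-1} < e_i and in Tr(e) if e_{i-1} = e_i.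
-- Otherwise e_{i-1} > e_i, and since i is not a valley, e_i ≥ e_{i+1}; in particular
-- i < n. For i ≥ 2 the letters e_{i-1} e_i e_{i+1} then form a 100 or a 210 pattern,
-- and for i = 1 the inversion condition forces e_1 = e_2 = 0, so that 1 ∈ Tr(e).
module Submission where

open import Defs
open import Data.Nat using (ℕ; zero; suc; _≤_; _<_; _<?_; _≤?_; z≤n; s≤s; z<s)
open import Data.Nat.Properties
  using (<-cmp; <-asym; <-irrefl; <-trans; >⇒≢; ≮⇒≥; n≤0⇒n≡0; n<1+n; m≤n⇒m<n∨m≡n)
open import Data.Fin using (Fin; toℕ; fromℕ<)
open import Data.Fin.Properties using (toℕ-fromℕ<)
open import Data.Maybe using (just; nothing)
open import Data.Maybe.Properties using (just-injective)
open import Data.Product using (_×_; _,_; proj₁; proj₂)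
open import Data.Sum using (_⊎_; inj₁; inj₂)
open import Data.Empty using (⊥-elim)
open import Function using (_∘_; case_of_)
open import Function.Bundles using (_⇔_; mk⇔)
open import Relation.Binary.Definitions using (Trichotomous; Decidable; tri<; tri≈; tri>)
open import Relation.Binary.Consequences using (tri⇒dec<; tri⇒dec≈)
open import Relation.Binary.PropositionalEquality
  using (_≡_; refl; sym; trans; cong; subst₂)
open import Relation.Nullary using (¬_; Dec; yes; no)
open import Relation.Nullary.Decidable using (_×-dec_; _⊎-dec_; ¬?; decidable-stable)

<∞-cmp : Trichotomous _≡_ _<∞_
<∞-cmp (just a) (just b) with <-cmp a b
... | tri< a<b a≢b a≯b = tri< (fin<fin a<b) (a≢b ∘ just-injective) λ { (fin<fin b<a) → a≯b b<a }
... | tri≈ a≮b a≡b a≯b = tri≈ (λ { (fin<fin a<b) → a≮b a<b }) (cong just a≡b) λ { (fin<fin b<a) → a≯b b<a }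
... | tri> a≮b a≢b b<a = tri> (λ { (fin<fin a<b) → a≮b a<b }) (a≢b ∘ just-injective) (fin<fin b<a)
<∞-cmp (just a) nothing = tri< fin<∞ (λ ()) (λ ())
<∞-cmp nothing (just b) = tri> (λ ()) (λ ()) fin<∞
<∞-cmp nothing nothing = tri≈ (λ ()) refl (λ ())

_<∞?_ : Decidable _<∞_
_<∞?_ = tri⇒dec< <∞-cmp

_≟∞_ : Decidable {A = ℕ∞} _≡_
_≟∞_ = tri⇒dec≈ <∞-cmp

fin<fin⁻¹ : ∀ {a b} → just a <∞ just b → a < b
fin<fin⁻¹ (fin<fin a<b) = a<b

fin≮fin⇒≥ : ∀ {a b} → just a ≥∞ just b → b ≤ a
fin≮fin⇒≥ a≮b = ≮⇒≥ (a≮b ∘ fin<fin)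

SameOrder-> : ∀ {a b x y} → b < a → y < x → SameOrder a b x y
SameOrder-> b<a y<x =
  mk⇔ (⊥-elim ∘ <-asym b<a) (⊥-elim ∘ <-asym y<x) , mk⇔ (⊥-elim ∘ >⇒≢ b<a) (⊥-elim ∘ >⇒≢ y<x)

SameOrder-≡ : ∀ {a b x y} → a ≡ b → x ≡ y → SameOrder a b x y
SameOrder-≡ refl refl =
  mk⇔ (⊥-elim ∘ <-irrefl refl) (⊥-elim ∘ <-irrefl refl) , mk⇔ (λ _ → refl) (λ _ → refl)

module _ {n : ℕ} (e : Fin n → ℕ) where

  no-descent-then-weak-descent : Avoids e 1 0 0 → Avoids e 2 1 0 →
    ∀ i j k → toℕ i < toℕ j → toℕ j < toℕ k → e j < e i → ¬ (e k ≤ e j)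
  no-descent-then-weak-descent av100 av210 i j k i<j j<k ej<ei ek≤ej
    with m≤n⇒m<n∨m≡n ek≤ej
  ... | inj₁ ek<ej = av210 i j k i<j j<k
    (SameOrder-> ej<ei (n<1+n 1) , SameOrder-> (<-trans ek<ej ej<ei) z<s , SameOrder-> ek<ej z<s)
  ... | inj₂ ek≡ej = av100 i j k i<j j<k
    (SameOrder-> ej<ei z<s , SameOrder-> (subst₂ _<_ (sym ek≡ej) refl ej<ei) z<s ,
     SameOrder-≡ (sym ek≡ej) refl)

  at-within : ∀ {k} (k<n : k < n) → at e (suc k) ≡ just (e (fromℕ< k<n))
  at-within {k} k<n with k <? n
  ... | yes _ = refl
  ... | no k≮n = ⊥-elim (k≮n k<n)

  at-beyond : ∀ {k} → ¬ (k < n) → at e (suc k) ≡ nothing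
  at-beyond {k} k≮n with k <? n
  ... | yes k<n = ⊥-elim (k≮n k<n)
  ... | no _ = refl

  at-defined⇒< : ∀ {k a} → at e (suc k) ≡ just a → k < n
  at-defined⇒< {k} defined = decidable-stable (k <? n) λ k≮n →
    case trans (sym (at-beyond k≮n)) defined of λ ()

  nonascent⇒not-last : ∀ {k} → k < n → at e (suc k) ≥∞ at e (suc (suc k)) → suc k < n
  nonascent⇒not-last {k} k<n nonasc = decidable-stable (suc k <? n) λ k+1≮n →
    nonasc (subst₂ _<∞_ (sym (at-within k<n)) (sym (at-beyond k+1≮n)) fin<∞)

  descent-nonascent⇒initial-zeros : IsInversionSeq n e → Avoids e 1 0 0 → Avoids e 2 1 0 →
    ∀ k → suc k ≤ n → at e (suc k) <∞ at e k → at e (suc k) ≥∞ at e (suc (suc k)) →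
    suc k ≡ 1 × at e 1 ≡ just 0 × at e 2 ≡ just 0
  descent-nonascent⇒initial-zeros inv av100 av210 zero 0<n desc nonasc =
    refl , trans (at-within 0<n) (cong just e₁≡0) , trans (at-within 1<n) (cong just e₂≡0)
    where
    1<n : 1 < n
    1<n = nonascent⇒not-last 0<n nonasc
    e₁≡0 : e (fromℕ< 0<n) ≡ 0
    e₁≡0 = n≤0⇒n≡0 (subst₂ _≤_ refl (toℕ-fromℕ< 0<n) (inv (fromℕ< 0<n)))
    e₂≡0 : e (fromℕ< 1<n) ≡ 0
    e₂≡0 = n≤0⇒n≡0 (subst₂ _≤_ refl e₁≡0
      (fin≮fin⇒≥ (nonasc ∘ subst₂ _<∞_ (sym (at-within 0<n)) (sym (at-within 1<n)))))
  descent-nonascent⇒initial-zeros inv av100 av210 (suc k) k+1<n desc nonasc =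
    ⊥-elim (no-descent-then-weak-descent av100 av210
      (fromℕ< k<n) (fromℕ< k+1<n) (fromℕ< k+2<n)
      (toℕ-fromℕ<-step k<n k+1<n) (toℕ-fromℕ<-step k+1<n k+2<n)
      (fin<fin⁻¹ (subst₂ _<∞_ (at-within k+1<n) (at-within k<n) desc))
      (fin≮fin⇒≥ (nonasc ∘ subst₂ _<∞_ (sym (at-within k+1<n)) (sym (at-within k+2<n)))))
    where
    k<n : k < n
    k<n = <-trans (n<1+n k) k+1<n
    k+2<n : suc (suc k) < n
    k+2<n = nonascent⇒not-last k+1<n nonasc
    toℕ-fromℕ<-step : ∀ {m} (m<n : m < n) (m+1<n : suc m < n) →
      toℕ (fromℕ< m<n) < toℕ (fromℕ< m+1<n)
    toℕ-fromℕ<-step {m} m<n m+1<n =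
      subst₂ _<_ (sym (toℕ-fromℕ< m<n)) (sym (toℕ-fromℕ< m+1<n)) (n<1+n m)

  In? : (i : ℕ) → Dec (In[ n ] i)
  In? i = (1 ≤? i) ×-dec (i ≤? n)

  Pk? : (i : ℕ) → Dec (Pk e i)
  Pk? zero = no λ ()
  Pk? (suc k) =
    In? _ ×-dec (at e k <∞? at e (suc k)) ×-dec ¬? (at e (suc k) <∞? at e (suc (suc k)))

  Va? : (i : ℕ) → Dec (Va e i)
  Va? zero = no λ ()
  Va? (suc k) =
    In? _ ×-dec ¬? (at e k <∞? at e (suc k)) ×-dec (at e (suc k) <∞? at e (suc (suc k)))

  Sf? : (i : ℕ) → Dec (Sf e i)
  Sf? zero = no λ ()
  Sf? (suc zero) = no λ ()
  Sf? (suc (suc zero)) = no λ ()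
  Sf? (suc (suc (suc k))) =
    In? _ ×-dec (at e _ <∞? at e _) ×-dec (at e _ ≟∞ at e _) ×-dec ¬? (at e _ ≟∞ at e _)

  Su? : (i : ℕ) → Dec (Su e i)
  Su? zero = no λ ()
  Su? (suc zero) = no λ ()
  Su? (suc (suc zero)) = no λ ()
  Su? (suc (suc (suc k))) =
    In? _ ×-dec (at e _ <∞? at e _) ×-dec (at e _ ≟∞ at e _) ×-dec (at e _ ≟∞ at e _)

  Fix? : (i : ℕ) → Dec (Fix e i)
  Fix? i = (Pk? i ×-dec ¬? (Su? i)) ⊎-dec Va? i ⊎-dec Sf? i

  Fix⊎Tr⊎Tl⇒In : ∀ i → Fix e i ⊎ Tr e i ⊎ Tl e i → In[ n ] i
  Fix⊎Tr⊎Tl⇒In (suc k) (inj₁ (inj₁ (pk , _))) = proj₁ pk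
  Fix⊎Tr⊎Tl⇒In (suc k) (inj₁ (inj₂ (inj₁ va))) = proj₁ va
  Fix⊎Tr⊎Tl⇒In (suc (suc (suc k))) (inj₁ (inj₂ (inj₂ sf))) = proj₁ sf
  Fix⊎Tr⊎Tl⇒In (suc k) (inj₂ (inj₁ (inj₁ tr))) = proj₁ tr
  Fix⊎Tr⊎Tl⇒In (suc k) (inj₂ (inj₁ (inj₂ (inj₁ (refl , e₁≡0 , _))))) = s≤s z≤n , at-defined⇒< e₁≡0
  Fix⊎Tr⊎Tl⇒In (suc (suc (suc k))) (inj₂ (inj₁ (inj₂ (inj₂ su)))) = proj₁ su
  Fix⊎Tr⊎Tl⇒In (suc k) (inj₂ (inj₂ tl)) = proj₁ tl

proposition2p3 : (n : ℕ) → 1 ≤ n → (e : Fin n → ℕ) → InI-100-210-201 n e →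
    ∀ (i : ℕ) → (Fix e i ⊎ Tr e i ⊎ Tl e i) ⇔ In[ n ] i
proposition2p3 n _ e (inv , av100 , av210 , _) i = mk⇔ (Fix⊎Tr⊎Tl⇒In e i) (covered i)
  where
  covered : ∀ i → In[ n ] i → Fix e i ⊎ Tr e i ⊎ Tl e i
  covered (suc k) i∈ with Fix? e (suc k) | <∞-cmp (at e k) (at e (suc k))
  ... | yes fix | _ = inj₁ fix
  ... | no ¬fix | tri< ascent _ _ = inj₂ (inj₂ (i∈ , ¬fix , ascent))
  ... | no ¬fix | tri≈ _ level _ = inj₂ (inj₁ (inj₁ (i∈ , ¬fix , level)))
  ... | no ¬fix | tri> ¬ascent _ descent = inj₂ (inj₁ (inj₂ (inj₁
    (descent-nonascent⇒initial-zeros e inv av100 av210 k (proj₂ i∈) descent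
      λ ascent → ¬fix (inj₂ (inj₁ (i∈ , ¬ascent , ascent)))))))
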